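{- A lattice effect algebra $\mathbf E=(E;\oplus,',0,1)$ is an MV-effect algebra if and only if its corresponding effect groupoid $\mathbb R(\mathbf E)=(E;\cdot,',0,1)$ is commutative.
   Context: An effect algebra is a partial algebra $(E;\oplus,',0,1)$ with $\oplus$ partial binary, such that: (E1) if $x\oplus y$ exists then $y\oplus x$ exists and equals it; (E2) if $x\oplus y$ and $(x\oplus y)\oplus z$ exist then $y\oplus z$ and $x\oplus(y\oplus z)$ exist and $(x\oplus y)\oplus z=x\oplus(y\oplus z)$; (E3) $x'$ is the unique element with $x\oplus x'$ defined and equal to $1$; (E4) if $x\oplus 1$ exists then $x=0$. Its induced order is $a\leq b$ iff $a\oplus c=b$ for some $c$. A lattice effect algebra is one whose induced order is a lattice, with meet $\wedge$. An MV-effect algebra is a lattice effect algebra with $(x\wedge y')\oplus y=(y\wedge x')\oplus x$ for all $x,y$. The corresponding effect groupoid is $\mathbb R(\mathbf E)=(E;\cdot,',0,1)$ with $x\cdot y:=((x'\wedge y)\oplus y')'$. -}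

module Defs where

open import Level using (Level; suc)
open import Data.Maybe using (Maybe; just; map)
open import Data.Product using (Σ; ∃; _×_)
open import Relation.Binary.PropositionalEquality using (_≡_)

-- An effect algebra (E; ⊕, ', 0, 1); the partial operation ⊕ is a
-- function into Maybe E (nothing = undefined).
record EffectAlgebra (ℓ : Level) : Set (suc ℓ) where
  infixl 6 _⊕_
  field
    E    : Set ℓ
    _⊕_  : E → E → Maybe E
    _′   : E → E
    𝟘    : E
    𝟙    : E
    E1 : ∀ x y u → x ⊕ y ≡ just u → y ⊕ x ≡ just u
    E2 : ∀ x y z u v → x ⊕ y ≡ just u → u ⊕ z ≡ just v →
         Σ E (λ w → (y ⊕ z ≡ just w) × (x ⊕ w ≡ just v))
    E3-exists : ∀ x → x ⊕ (x ′) ≡ just 𝟙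
    E3-unique : ∀ x y → x ⊕ y ≡ just 𝟙 → y ≡ x ′
    E4 : ∀ x u → x ⊕ 𝟙 ≡ just u → x ≡ 𝟘

  _≤_ : E → E → Set ℓ
  a ≤ b = Σ E (λ c → a ⊕ c ≡ just b)

record LatticeEffectAlgebra (ℓ : Level) : Set (suc ℓ) where
  field
    effectAlgebra : EffectAlgebra ℓ
  open EffectAlgebra effectAlgebra public
  infixr 7 _∧_
  infixr 6 _∨_
  field
    _∧_ : E → E → E
    ∧-lb₁ : ∀ x y → (x ∧ y) ≤ x
    ∧-lb₂ : ∀ x y → (x ∧ y) ≤ y
    ∧-glb : ∀ x y z → z ≤ x → z ≤ y → z ≤ (x ∧ y)
    _∨_ : E → E → E
    ∨-ub₁ : ∀ x y → x ≤ (x ∨ y)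
    ∨-ub₂ : ∀ x y → y ≤ (x ∨ y)
    ∨-lub : ∀ x y z → x ≤ z → y ≤ z → (x ∨ y) ≤ z

module _ {ℓ : Level} (L : LatticeEffectAlgebra ℓ) where
  open LatticeEffectAlgebra L

  IsMVEffectAlgebra : Set ℓ
  IsMVEffectAlgebra = ∀ x y → ((x ∧ (y ′)) ⊕ y) ≡ ((y ∧ (x ′)) ⊕ x)

  -- effect groupoid product: x · y := ((x′ ∧ y) ⊕ y′)′
  -- (always defined, since x′ ∧ y ≤ y = (y′)′; Maybe-valued here)
  _·_ : E → E → Maybe E
  x · y = map _′ (((x ′) ∧ y) ⊕ (y ′))

  IsCommutativeGroupoid : Set ℓ
  IsCommutativeGroupoid = ∀ x y → (x · y) ≡ (y · x)

module Submission where

-- Write  d(x, y) := (x ∧ y′) ⊕ y.  By definition E is an MV-effect algebra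
-- exactly when d is symmetric.  Because x′′ = x, the groupoid product is
--   x · y = ((x′ ∧ y) ⊕ y′)′ = d(x′, y′)′,
-- so commutativity of · says  d(x′, y′)′ = d(y′, x′)′  for all x, y.
-- Complementation is injective (on Maybe E as well, via map), so this is
-- the symmetry of d on complements, and since complementation is an
-- involution every pair of elements is a pair of complements; hence it is
-- the symmetry of d itself.

open import Level using (Level)
open import Function.Bundles using (_⇔_; mk⇔)
import Function.Properties.Equivalence as ⇔
open import Data.Maybe using (Maybe; map)
open import Data.Maybe.Properties using (map-injective)
open import Relation.Binary.PropositionalEquality
open import Defs

-- In any effect algebra complementation is self-inverse: x′ = y implies
-- y′ = x.  Indeed y = x′ gives x′ ⊕ x = 1 by (E1), so x is the unique
-- complement of y by (E3).
module Complement {ℓ : Level} (EA : EffectAlgebra ℓ) where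
  open EffectAlgebra EA
  open import Algebra.Definitions {A = E} _≡_ using (SelfInverse; Involutive)
  open import Algebra.Consequences.Propositional {A = E}
    using (selfInverse⇒involutive; selfInverse⇒injective)
  open import Function.Definitions using (Injective)

  ′-selfInverse : SelfInverse _′
  ′-selfInverse {x} refl = sym (E3-unique (x ′) x (E1 x (x ′) 𝟙 (E3-exists x)))

  ′-involutive : Involutive _′
  ′-involutive = selfInverse⇒involutive ′-selfInverse

  ′-injective : Injective _≡_ _≡_ _′
  ′-injective = selfInverse⇒injective ′-selfInverse

-- A binary function is symmetric iff it is symmetric after both arguments
-- are reindexed along an involution f: every pair (x, y) is the image
-- (f (f x), f (f y)) of a pair of f-values.
symmetric-along-involution : ∀ {a b} {A : Set a} {B : Set b}
  (f : A → A) → (∀ x → f (f x) ≡ x) → (d : A → A → B) →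
  (∀ x y → d x y ≡ d y x) ⇔ (∀ x y → d (f x) (f y) ≡ d (f y) (f x))
symmetric-along-involution f f-involutive d = mk⇔ restrict extend
  where
  restrict : (∀ x y → d x y ≡ d y x) → ∀ x y → d (f x) (f y) ≡ d (f y) (f x)
  restrict d-sym x y = d-sym (f x) (f y)

  extend : (∀ x y → d (f x) (f y) ≡ d (f y) (f x)) → ∀ x y → d x y ≡ d y x
  extend d-sym-f x y =
    subst₂ (λ u v → d u v ≡ d v u) (f-involutive x) (f-involutive y)
           (d-sym-f (f x) (f y))

module Groupoid {ℓ : Level} (L : LatticeEffectAlgebra ℓ) where
  open LatticeEffectAlgebra L
  open Complement effectAlgebra using (′-involutive; ′-injective)

  mvTerm : E → E → Maybe E
  mvTerm x y = (x ∧ y ′) ⊕ y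

  ·-via-mvTerm : ∀ x y → (_·_ L x y) ≡ map _′ (mvTerm (x ′) (y ′))
  ·-via-mvTerm x y =
    cong (λ z → map _′ ((x ′ ∧ z) ⊕ y ′)) (sym (′-involutive y))

  commutative⇔mvTerm-sym-on-complements :
    IsCommutativeGroupoid L ⇔ (∀ x y → mvTerm (x ′) (y ′) ≡ mvTerm (y ′) (x ′))
  commutative⇔mvTerm-sym-on-complements = mk⇔
    (λ comm x y → map-injective ′-injective (begin
      map _′ (mvTerm (x ′) (y ′)) ≡⟨ sym (·-via-mvTerm x y) ⟩
      _·_ L x y                   ≡⟨ comm x y ⟩
      _·_ L y x                   ≡⟨ ·-via-mvTerm y x ⟩
      map _′ (mvTerm (y ′) (x ′)) ∎))
    (λ sym-d x y → begin
      _·_ L x y                   ≡⟨ ·-via-mvTerm x y ⟩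
      map _′ (mvTerm (x ′) (y ′)) ≡⟨ cong (map _′) (sym-d x y) ⟩
      map _′ (mvTerm (y ′) (x ′)) ≡⟨ sym (·-via-mvTerm y x) ⟩
      _·_ L y x                   ∎)
    where open ≡-Reasoning

  mv⇔commutative : IsMVEffectAlgebra L ⇔ IsCommutativeGroupoid L
  mv⇔commutative =
    ⇔.trans
      (symmetric-along-involution _′ ′-involutive mvTerm)
      (⇔.sym commutative⇔mvTerm-sym-on-complements)

mainTheorem6 : {ℓ : Level} (L : LatticeEffectAlgebra ℓ) →
    IsMVEffectAlgebra L ⇔ IsCommutativeGroupoid L
mainTheorem6 L = Groupoid.mv⇔commutative L
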